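{- In each of the two deduction systems DBL and DBL$_\ast$, for all formulas $\phi,\psi\in\mathcal{L}$ the sequent $\neg\phi\vdash\psi\times\phi$ is derivable. In particular $(\psi|\bot)\equiv\psi$ for every $\psi\in\mathcal{L}$.
   Context: Fix a finite set $\Theta$ of atomic propositions and a distinguished $\theta_1\in\Theta$. The language $\mathcal{L}$ is the smallest set containing $\Theta$ such that $\neg\phi$, $\phi\rightarrow\psi$ and $(\psi|\phi)$ belong to $\mathcal{L}$ whenever $\phi,\psi\in\mathcal{L}$. Abbreviations: $\phi\vee\psi:=\neg\phi\rightarrow\psi$, $\phi\wedge\psi:=\neg(\neg\phi\vee\neg\psi)$, $\phi\leftrightarrow\psi:=(\phi\rightarrow\psi)\wedge(\psi\rightarrow\phi)$, $\psi\times\phi:=(\psi|\phi)\leftrightarrow\psi$, $\top:=\theta_1\rightarrow\theta_1$, $\bot:=\neg\top$. A sequent is a pair of finite (possibly empty) sequences $\Gamma,\Delta$ of formulas of $\mathcal{L}$, written $\Gamma\vdash\Delta$; "$\Gamma,\Delta$" denotes concatenation and $\{\Gamma\}$ the set of entries of $\Gamma$. The systems DBL and DBL$_\ast$ are the smallest sets of sequents $X$ satisfying, for all $\phi,\psi,\eta\in\mathcal{L}$ and finite sequences $\Gamma,\Delta,\Lambda,\Sigma$: (CUT) if $\Gamma\vdash\Delta,\phi$ and $\Lambda,\phi\vdash\Sigma$ are in $X$ then $\Gamma,\Lambda\vdash\Delta,\Sigma$ is in $X$; (STRUCT) if $\{\Gamma\}\subset\{\Lambda\}\cup\{\top\}$,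 $\{\Delta\}\subset\{\Sigma\}\cup\{\bot\}$ and $\Gamma\vdash\Delta$ is in $X$ then $\Lambda\vdash\Sigma$ is in $X$; (modus ponens) $\phi,\phi\rightarrow\psi\vdash\psi$; (c1) $\vdash\phi\rightarrow(\psi\rightarrow\phi)$; (c2) $\vdash(\eta\rightarrow(\phi\rightarrow\psi))\rightarrow((\eta\rightarrow\phi)\rightarrow(\eta\rightarrow\psi))$; (c3) $\vdash(\neg\phi\rightarrow\neg\psi)\rightarrow((\neg\phi\rightarrow\psi)\rightarrow\phi)$; (b1) $\phi\rightarrow\psi\vdash\neg\phi,(\psi|\phi)$; (b2) $\vdash(\psi\rightarrow\eta|\phi)\rightarrow((\psi|\phi)\rightarrow(\eta|\phi))$; (b3) $\vdash(\psi|\phi)\rightarrow(\phi\rightarrow\psi)$; (b4) $\vdash\neg(\neg\psi|\phi)\leftrightarrow(\psi|\phi)$. DBL additionally contains (b5) $\psi\times\phi\vdash\phi\times\psi$. DBL$_\ast$ instead additionally contains (b5.weak.A) $\psi\times\neg\phi\vdash\psi\times\phi$ and $\psi\times\phi\vdash\psi\times\neg\phi$, and (b5.weak.B) $\psi\leftrightarrow\eta\vdash(\phi|\psi)\leftrightarrow(\phi|\eta)$. A sequent is derivable if it belongs to the system; $\phi\equiv\psi$ means that $\vdash\phi\leftrightarrow\psi$ is derivable. -}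

module Defs where

open import Data.Nat using (ℕ; suc)
open import Data.Fin using (Fin; zero)
open import Data.List using (List; []; _∷_; _++_)
open import Data.List.Membership.Propositional using (_∈_)
open import Data.Sum using (_⊎_)
open import Data.Product using (_×_)
open import Relation.Binary.PropositionalEquality using (_≡_)

-- Atomic propositions: Θ = Fin (suc n) (finite, nonempty); θ₁ = zero.
data Form (n : ℕ) : Set where
  atom : Fin (suc n) → Form n
  ¬'_  : Form n → Form n
  _⇒_  : Form n → Form n → Form n
  cond : Form n → Form n → Form n   -- cond ψ φ  is  (ψ|φ)

infixr 5 _⇒_

module _ {n : ℕ} where
  θ₁ : Form n
  θ₁ = atom zero

  _∨'_ : Form n → Form n → Form n
  φ ∨' ψ = (¬' φ) ⇒ ψ

  _∧'_ : Form n → Form n → Form n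
  φ ∧' ψ = ¬' ((¬' φ) ∨' (¬' ψ))

  _⇔_ : Form n → Form n → Form n
  φ ⇔ ψ = (φ ⇒ ψ) ∧' (ψ ⇒ φ)

  _⊠_ : Form n → Form n → Form n
  ψ ⊠ φ = cond ψ φ ⇔ ψ

  ⊤' : Form n
  ⊤' = θ₁ ⇒ θ₁

  ⊥' : Form n
  ⊥' = ¬' ⊤'

data System : Set where
  DBL DBL* : System

data _⊢[_]_ {n : ℕ} : List (Form n) → System → List (Form n) → Set where
  cut : ∀ {S Γ Δ Λ Σ φ} →
        Γ ⊢[ S ] (Δ ++ φ ∷ []) → (Λ ++ φ ∷ []) ⊢[ S ] Σ →
        (Γ ++ Λ) ⊢[ S ] (Δ ++ Σ)
  struct : ∀ {S Γ Δ Λ Σ} →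
        (∀ {x} → x ∈ Γ → x ∈ Λ ⊎ x ≡ ⊤') →
        (∀ {x} → x ∈ Δ → x ∈ Σ ⊎ x ≡ ⊥') →
        Γ ⊢[ S ] Δ → Λ ⊢[ S ] Σ
  mp : ∀ {S φ ψ} → (φ ∷ (φ ⇒ ψ) ∷ []) ⊢[ S ] (ψ ∷ [])
  c1 : ∀ {S φ ψ} → [] ⊢[ S ] ((φ ⇒ (ψ ⇒ φ)) ∷ [])
  c2 : ∀ {S η φ ψ} →
       [] ⊢[ S ] (((η ⇒ (φ ⇒ ψ)) ⇒ ((η ⇒ φ) ⇒ (η ⇒ ψ))) ∷ [])
  c3 : ∀ {S φ ψ} →
       [] ⊢[ S ] ((((¬' φ) ⇒ (¬' ψ)) ⇒ (((¬' φ) ⇒ ψ) ⇒ φ)) ∷ [])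
  b1 : ∀ {S φ ψ} → ((φ ⇒ ψ) ∷ []) ⊢[ S ] ((¬' φ) ∷ cond ψ φ ∷ [])
  b2 : ∀ {S φ ψ η} →
       [] ⊢[ S ] ((cond (ψ ⇒ η) φ ⇒ (cond ψ φ ⇒ cond η φ)) ∷ [])
  b3 : ∀ {S φ ψ} → [] ⊢[ S ] ((cond ψ φ ⇒ (φ ⇒ ψ)) ∷ [])
  b4 : ∀ {S φ ψ} → [] ⊢[ S ] (((¬' (cond (¬' ψ) φ)) ⇔ cond ψ φ) ∷ [])
  b5 : ∀ {φ ψ} → ((ψ ⊠ φ) ∷ []) ⊢[ DBL ] ((φ ⊠ ψ) ∷ [])
  b5wA₁ : ∀ {φ ψ} → ((ψ ⊠ (¬' φ)) ∷ []) ⊢[ DBL* ] ((ψ ⊠ φ) ∷ [])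
  b5wA₂ : ∀ {φ ψ} → ((ψ ⊠ φ) ∷ []) ⊢[ DBL* ] ((ψ ⊠ (¬' φ)) ∷ [])
  b5wB : ∀ {φ ψ η} → ((ψ ⇔ η) ∷ []) ⊢[ DBL* ] ((cond φ ψ ⇔ cond φ η) ∷ [])

_≣[_]_ : {n : ℕ} → Form n → System → Form n → Set
φ ≣[ S ] ψ = [] ⊢[ S ] ((φ ⇔ ψ) ∷ [])

{-# OPTIONS --safe #-}
-- If φ holds, b3 gives (ψ|φ) → ψ and b3, b4 give ψ → (ψ|φ); so ¬φ ⊢ ψ × ¬φ.
-- It remains to pass from ψ × ¬φ to ψ × φ. In DBL* this is b5.weak.A. In DBL,
-- b4 turns ¬φ × ψ into φ × ψ, since (φ|ψ) ↔ ¬(¬φ|ψ) ↔ ¬¬φ ↔ φ; symmetry (b5)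
-- on either side of this step does the rest. Taking φ = ⊥ and discharging the
-- provable ¬⊥ gives (ψ|⊥) ≡ ψ.
module Submission where

open import Defs
open import Data.Nat using (ℕ)
open import Data.List using (List; []; _∷_)
open import Data.Product using (_×_; _,_)

module Hilbert {n : ℕ} {S : System} where

  private variable
    A B C : Form n
    Γ : List (Form n)

  infix 1 ⊢_ _⊩_

  ⊢_ : Form n → Set
  ⊢ A = [] ⊢[ S ] (A ∷ [])

  detach : ⊢ A → (A ∷ []) ⊢[ S ] (B ∷ []) → ⊢ B
  detach = cut {Γ = []} {Δ = []} {Λ = []}

  _⨾_ : (A ∷ []) ⊢[ S ] (B ∷ []) → (B ∷ []) ⊢[ S ] (C ∷ []) → (A ∷ []) ⊢[ S ] (C ∷ [])
  _⨾_ {A = A} = cut {Γ = A ∷ []} {Δ = []} {Λ = []}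

  fromImplication : ⊢ A ⇒ B → (A ∷ []) ⊢[ S ] (B ∷ [])
  fromImplication {A = A} ⊢A⇒B = cut {Γ = []} {Δ = []} {Λ = A ∷ []} ⊢A⇒B mp

  modusPonens : ⊢ A → ⊢ A ⇒ B → ⊢ B
  modusPonens ⊢A ⊢A⇒B = detach ⊢A (fromImplication ⊢A⇒B)

  ⇒-refl : ⊢ A ⇒ A
  ⇒-refl {A = A} = modusPonens (c1 {ψ = A}) (modusPonens (c1 {ψ = A ⇒ A}) c2)

  -- Γ ⊩ A proves the implication from the hypotheses in Γ (most recent first)
  -- to A. Extending Γ is then λ-abstraction, so the deduction theorem holds by
  -- definition, and app and pure are implemented by the combinators c2 and c1.
  _⇒*_ : List (Form n) → Form n → Form n
  [] ⇒* A = A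
  (B ∷ Γ) ⇒* A = Γ ⇒* (B ⇒ A)

  record _⊩_ (Γ : List (Form n)) (A : Form n) : Set where
    constructor ⟨_⟩
    field proof : ⊢ Γ ⇒* A

  close : [] ⊩ A → ⊢ A
  close ⟨ p ⟩ = p

  lam : B ∷ Γ ⊩ A → Γ ⊩ B ⇒ A
  lam ⟨ p ⟩ = ⟨ p ⟩

  unlam : Γ ⊩ B ⇒ A → B ∷ Γ ⊩ A
  unlam ⟨ p ⟩ = ⟨ p ⟩

  app : Γ ⊩ A ⇒ B → Γ ⊩ A → Γ ⊩ B
  pure : ⊢ A → Γ ⊩ A

  app {Γ = []} ⟨ f ⟩ ⟨ x ⟩ = ⟨ modusPonens x f ⟩
  app {Γ = C ∷ Γ} f x = unlam (app (app (pure c2) (lam f)) (lam x))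

  pure {Γ = []} t = ⟨ t ⟩
  pure {Γ = C ∷ Γ} t = unlam (app (pure c1) (pure t))

  var : A ∷ Γ ⊩ A
  var = unlam (pure ⇒-refl)

  wk : Γ ⊩ A → B ∷ Γ ⊩ A
  wk p = unlam (app (pure c1) p)

  by : ⊢ A ⇒ B → Γ ⊩ A → Γ ⊩ B
  by t = app (pure t)

  by₂ : ⊢ A ⇒ B ⇒ C → Γ ⊩ A → Γ ⊩ B → Γ ⊩ C
  by₂ t p = app (by t p)

  ⇒-trans : Γ ⊩ A ⇒ B → Γ ⊩ B ⇒ C → Γ ⊩ A ⇒ C
  ⇒-trans f g = lam (app (wk g) (app (wk f) var))

  ex-falso : ⊢ ¬' A ⇒ A ⇒ B
  ex-falso = close (lam (lam (by₂ c3 (lam (wk (wk var))) (lam (wk var)))))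

  ¬¬-elim : ⊢ ¬' ¬' A ⇒ A
  ¬¬-elim = close (lam (by₂ c3 (lam (wk var)) (pure ⇒-refl)))

  ¬¬-intro : ⊢ A ⇒ ¬' ¬' A
  ¬¬-intro = close (lam (by₂ c3 (pure ¬¬-elim) (lam (wk var))))

  contraposition : ⊢ (A ⇒ B) ⇒ ¬' B ⇒ ¬' A
  contraposition =
    close (lam (lam (by₂ c3 (lam (wk var)) (lam (app (wk (wk var)) (by ¬¬-elim var))))))

  ¬⇒-intro : ⊢ A ⇒ ¬' B ⇒ ¬' (A ⇒ B)
  ¬⇒-intro =
    close (lam (lam (by₂ c3 (lam (wk var)) (lam (app (by ¬¬-elim var) (wk (wk var)))))))

  ¬⇒-elimˡ : ⊢ ¬' (A ⇒ B) ⇒ A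
  ¬⇒-elimˡ = close (lam (by ¬¬-elim (by₂ contraposition (pure ex-falso) var)))

  ¬⇒-elimʳ : ⊢ ¬' (A ⇒ B) ⇒ ¬' B
  ¬⇒-elimʳ = modusPonens c1 contraposition

  ∧-intro : ⊢ A ⇒ B ⇒ A ∧' B
  ∧-intro = close (lam (lam (by₂ ¬⇒-intro (by ¬¬-intro (wk var)) (by ¬¬-intro var))))

  ∧-elimˡ : ⊢ A ∧' B ⇒ A
  ∧-elimˡ = close (lam (by ¬¬-elim (by ¬⇒-elimˡ var)))

  ∧-elimʳ : ⊢ A ∧' B ⇒ B
  ∧-elimʳ = close (lam (by ¬¬-elim (by ¬⇒-elimʳ var)))

  ⇔-intro : Γ ⊩ A ⇒ B → Γ ⊩ B ⇒ A → Γ ⊩ A ⇔ B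
  ⇔-intro = by₂ ∧-intro

  ⇔-to : Γ ⊩ A ⇔ B → Γ ⊩ A ⇒ B
  ⇔-to = by ∧-elimˡ

  ⇔-from : Γ ⊩ A ⇔ B → Γ ⊩ B ⇒ A
  ⇔-from = by ∧-elimʳ

  ⇔-sym : Γ ⊩ A ⇔ B → Γ ⊩ B ⇔ A
  ⇔-sym p = ⇔-intro (⇔-from p) (⇔-to p)

  ⇔-trans : Γ ⊩ A ⇔ B → Γ ⊩ B ⇔ C → Γ ⊩ A ⇔ C
  ⇔-trans p q = ⇔-intro (⇒-trans (⇔-to p) (⇔-to q)) (⇒-trans (⇔-from q) (⇔-from p))

  ¬-cong : Γ ⊩ A ⇔ B → Γ ⊩ (¬' A) ⇔ (¬' B)
  ¬-cong p = ⇔-intro (by contraposition (⇔-from p)) (by contraposition (⇔-to p))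

  ¬¬-equiv : Γ ⊩ (¬' ¬' A) ⇔ A
  ¬¬-equiv = ⇔-intro (pure ¬¬-elim) (pure ¬¬-intro)

  cond-detach : Γ ⊩ A → Γ ⊩ cond B A ⇒ B
  cond-detach p = lam (app (by b3 var) (wk p))

  ⊠-intro : ⊢ A ⇒ B ⊠ A
  ⊠-intro = close (lam (⇔-intro (cond-detach var) from))
    where
    from : A ∷ [] ⊩ B ⇒ cond B A
    from = ⇒-trans (pure ¬¬-intro)
             (⇒-trans (by contraposition (cond-detach var)) (⇔-to (pure b4)))

  ⊠-¬-elim : ⊢ ((¬' A) ⊠ B) ⇒ (A ⊠ B)
  ⊠-¬-elim = close (lam (⇔-trans (⇔-sym (pure b4)) (⇔-trans (¬-cong var) ¬¬-equiv)))

open Hilbert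

private variable
  n : ℕ
  φ ψ : Form n

⊠-¬ʳ-elim : (S : System) → ((ψ ⊠ (¬' φ)) ∷ []) ⊢[ S ] ((ψ ⊠ φ) ∷ [])
⊠-¬ʳ-elim DBL  = b5 ⨾ (fromImplication ⊠-¬-elim ⨾ b5)
⊠-¬ʳ-elim DBL* = b5wA₁

¬-antecedent-⊠ : (S : System) (φ ψ : Form n) → ((¬' φ) ∷ []) ⊢[ S ] ((ψ ⊠ φ) ∷ [])
¬-antecedent-⊠ S φ ψ = fromImplication ⊠-intro ⨾ ⊠-¬ʳ-elim S

mainTheorem2 : (n : ℕ) → (S : System) →
    ((φ ψ : Form n) → ((¬' φ) ∷ []) ⊢[ S ] ((ψ ⊠ φ) ∷ []))
    × ((ψ : Form n) → cond ψ ⊥' ≣[ S ] ψ)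
mainTheorem2 n S =
  ¬-antecedent-⊠ S , λ ψ → detach (modusPonens ⇒-refl ¬¬-intro) (¬-antecedent-⊠ S ⊥' ψ)
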